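{- For each positive integer $j$, let $T_j=[\underbrace{2\;2\;\cdots\;2}_{j}]_4=\sum_{i=0}^{j-1}2\cdot 4^i$ and $U_j=[\underbrace{1\;1\;\cdots\;1}_{j}]_4=\sum_{i=0}^{j-1}4^i$. Then $$f_4(T_j+n)=b_4(n)\quad\text{for all integers } n\in[-U_j,\,U_{j+1}].$$ Moreover, $f_4(T_j+n)\neq b_4(n)$ when $n=-U_j-1$ and when $n=U_{j+1}+1$.
   Context: For an integer $n$, a hyperquaternary representation of $n$ is an expression $n=\sum_{i\ge 0}\epsilon_i 4^i$ with finitely many nonzero $\epsilon_i$ and all $\epsilon_i\in\{0,1,2,3,4\}$; $f_4(n)$ denotes the number of such representations (so $f_4(n)=0$ for $n<0$). A balanced quaternary representation of $n$ is such an expression with all $\epsilon_i\in\{ -2,-1,0,1,2\}$; $b_4(n)$ denotes the number of such representations. Representations differing only by leading zero digits are identified. The notation $[\epsilon_k\;\epsilon_{k-1}\;\cdots\;\epsilon_0]_4$ means $\sum_{i=0}^k\epsilon_i4^i$. -}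

module Defs where

open import Data.Nat as ℕ using (ℕ; zero; suc)
open import Data.Fin using (Fin; toℕ)
import Data.Fin as Fin
open import Data.Integer using (ℤ; +_; _+_; _*_; _-_; -_; 0ℤ)
open import Data.List using (List; []; _∷_; map; upTo)
open import Data.Nat.ListAction using (sum)
open import Data.Bool using (Bool; true; false; not)
open import Data.Product using (Σ; _×_)
open import Data.Unit using (⊤)
open import Function.Bundles using (_↔_)
open import Relation.Binary.PropositionalEquality using (_≡_)
import Data.Bool as B

HDigit : Set
HDigit = Fin 5

data BDigit : Set where
  m2 m1 z0 p1 p2 : BDigit

bval : BDigit → ℤ
bval m2 = - (+ 2)
bval m1 = - (+ 1)
bval z0 = + 0
bval p1 = + 1
bval p2 = + 2

-- Digit lists are little-endian: d₀ ∷ d₁ ∷ … means Σ dᵢ 4^i.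
evalH : List HDigit → ℤ
evalH []       = 0ℤ
evalH (d ∷ ds) = + toℕ d + + 4 * evalH ds

evalB : List BDigit → ℤ
evalB []       = 0ℤ
evalB (d ∷ ds) = bval d + + 4 * evalB ds

-- Normalisation (representations differing only by leading zeros are
-- identified): the most significant listed digit is nonzero; [] is allowed.
isZeroH : HDigit → Bool
isZeroH Fin.zero    = true
isZeroH (Fin.suc _) = false

isZeroB : BDigit → Bool
isZeroB z0 = true
isZeroB _  = false

normH : List HDigit → Bool
normH []           = true
normH (d ∷ [])     = not (isZeroH d)
normH (_ ∷ e ∷ ds) = normH (e ∷ ds)

normB : List BDigit → Bool
normB []           = true
normB (d ∷ [])     = not (isZeroB d)
normB (_ ∷ e ∷ ds) = normB (e ∷ ds)

HRep : ℤ → Set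
HRep n = Σ (List HDigit) λ ds → B.T (normH ds) × evalH ds ≡ n

BRep : ℤ → Set
BRep n = Σ (List BDigit) λ ds → B.T (normB ds) × evalB ds ≡ n

HasCard : Set → ℕ → Set
HasCard A m = A ↔ Fin m

f4≡ : ℤ → ℕ → Set
f4≡ n m = HasCard (HRep n) m

b4≡ : ℤ → ℕ → Set
b4≡ n m = HasCard (BRep n) m

Tj : ℕ → ℤ
Tj j = + sum (map (λ i → 2 ℕ.* 4 ℕ.^ i) (upTo j))

Uj : ℕ → ℤ
Uj j = + sum (map (λ i → 4 ℕ.^ i) (upTo j))

-- Peeling off the lowest digit gives the recurrences
--   f₄(4k + r) = f₄(k) for r = 1, 2, 3,     f₄(4k) = f₄(k) + f₄(k − 1),
--   b₄(4k + r) = b₄(k) for r = −1, 0, 1,    b₄(4k + 2) = b₄(k) + b₄(k + 1).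
-- Since T_{j+1} = 4 T_j + 2, writing n = 4q + r with r ∈ {−1, 0, 1, 2} gives
-- T_{j+1} + n = 4 (T_j + q) + (r + 2), so f₄(T_{j+1} + n) and b₄(n) unfold into
-- the same combination of the pairs f₄(T_j + q′), b₄(q′) with q′ ∈ {q, q + 1},
-- and these q′ lie in [−U_j, U_{j+1}] whenever n ∈ [−U_{j+1}, U_{j+2}].  Hence the
-- equality follows by induction on j, starting from j = 0.  At the two boundary
-- points the same unfolding pairs an in-range point of level j with a boundary
-- point of level j, where b₄ exceeds f₄ by one, so the excess of one propagates.
module Submission where

open import Defs
open import Data.Bool using (Bool; true; false; not; T; if_then_else_)
open import Data.Bool.Properties using (T-irrelevant)
open import Data.Empty using (⊥-elim)
open import Data.Fin as Fin using (toℕ)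
open import Data.Fin.Properties using (+↔⊎)
open import Data.Integer as ℤ using (ℤ; +_; -[1+_]; _+_; _-_; -_; _*_; 0ℤ; ∣_∣)
open import Data.Integer.DivMod using (_%ℕ_; _/ℕ_; n%ℕd<d; a≡a%ℕn+[a/ℕn]*n)
import Data.Integer.Properties as ℤP
open import Data.Integer.Tactic.RingSolver using (solve-∀; solve)
open import Data.List using (List; []; _∷_; map; upTo; applyUpTo)
open import Data.List.Properties using (map-applyUpTo; map-upTo)
open import Data.Nat as ℕ using (ℕ; zero; suc; _≤_; z≤n; s≤s)
open import Data.Nat.DivMod using (_%_; m*n%n≡0)
open import Data.Nat.ListAction using (sum)
import Data.Nat.Properties as ℕP
open import Data.Product using (Σ; Σ-syntax; _×_; _,_; proj₁; proj₂; map₂)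
open import Data.Sum using (_⊎_; inj₁; inj₂)
open import Data.Sum.Function.Propositional using (_⊎-cong_)
open import Data.Unit using (tt)
open import Function.Base using (_∘_)
open import Function.Bundles using (_↔_; mk↔ₛ′)
open import Function.Properties.Inverse using (↔-trans; ↔-sym)
open import Relation.Binary.PropositionalEquality
  using (_≡_; _≢_; refl; sym; trans; cong; cong₂; subst; module ≡-Reasoning)
open import Relation.Nullary using (¬_)
open import Algebra.Properties.AbelianGroup ℤP.+-0-abelianGroup using (∙-cancelˡ)
open import Algebra.Properties.CommutativeSemigroup ℕP.*-commutativeSemigroup using (x∙yz≈y∙xz)

private variable
  A : Set

proj₁-injective : {P : A → Bool} {f : A → ℤ} {n : ℤ} {x y : Σ A λ a → T (P a) × f a ≡ n} →
                  proj₁ x ≡ proj₁ y → x ≡ y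
proj₁-injective {x = a , p , refl} {y = .a , q , refl} refl =
  cong (λ r → a , r , refl) (T-irrelevant p q)

Σ-supported₁ : {F : A → Set} (a : A) → (∀ x → F x → x ≡ a) → Σ A F ↔ F a
Σ-supported₁ {F = F} a only = mk↔ₛ′ to (a ,_) to-from from-to
  where
  to : Σ _ F → F a
  to (x , y) = subst F (only x y) y
  to-from : ∀ y → to (a , y) ≡ y
  to-from y with only a y
  ... | refl = refl
  from-to : ∀ z → (a , to z) ≡ z
  from-to (x , y) with only x y
  ... | refl = refl

Σ-supported₂ : {F : A → Set} {a b : A} → a ≢ b → (∀ x → F x → x ≡ a ⊎ x ≡ b) →
               Σ A F ↔ (F a ⊎ F b)
Σ-supported₂ {F = F} {a} {b} a≢b only = mk↔ₛ′ to from to-from from-to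
  where
  to : Σ _ F → F a ⊎ F b
  to (x , y) with only x y
  ... | inj₁ refl = inj₁ y
  ... | inj₂ refl = inj₂ y
  from : F a ⊎ F b → Σ _ F
  from (inj₁ y) = a , y
  from (inj₂ y) = b , y
  to-from : ∀ z → to (from z) ≡ z
  to-from (inj₁ y) with only a y
  ... | inj₁ refl = refl
  ... | inj₂ a≡b  = ⊥-elim (a≢b a≡b)
  to-from (inj₂ y) with only b y
  ... | inj₁ b≡a  = ⊥-elim (a≢b (sym b≡a))
  ... | inj₂ refl = refl
  from-to : ∀ z → from (to z) ≡ z
  from-to (x , y) with only x y
  ... | inj₁ refl = refl
  ... | inj₂ refl = refl

HasCard-⊎ : ∀ {A B : Set} {a b} → HasCard A a → HasCard B b → HasCard (A ⊎ B) (a ℕ.+ b)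
HasCard-⊎ f g = ↔-trans (f ⊎-cong g) (↔-sym +↔⊎)

-- Congruence modulo 4, phrased so that it evaluates on closed integers: a case
-- split on digits then discharges every incongruent digit by an absurd pattern.
infix 4 _≡₄_
_≡₄_ : ℤ → ℤ → Set
a ≡₄ b = ∣ a - b ∣ % 4 ≡ 0

+4*-≡₄ : ∀ {a b x y} → a + + 4 * x ≡ b + + 4 * y → a ≡₄ b
+4*-≡₄ {a} {b} {x} {y} eq = begin
  ∣ a - b ∣ % 4           ≡⟨ cong (λ c → ∣ c ∣ % 4) a-b≡4[y-x] ⟩
  ∣ + 4 * (y - x) ∣ % 4   ≡⟨ cong (_% 4) (ℤP.abs-* (+ 4) (y - x)) ⟩
  (4 ℕ.* ∣ y - x ∣) % 4   ≡⟨ cong (_% 4) (ℕP.*-comm 4 ∣ y - x ∣) ⟩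
  (∣ y - x ∣ ℕ.* 4) % 4   ≡⟨ m*n%n≡0 ∣ y - x ∣ 4 ⟩
  0                       ∎
  where
  open ≡-Reasoning
  a-b≡4[y-x] : a - b ≡ + 4 * (y - x)
  a-b≡4[y-x] = begin
    a - b                           ≡⟨ solve (a ∷ b ∷ x ∷ []) ⟩
    (a + + 4 * x) - (b + + 4 * x)   ≡⟨ cong (_- (b + + 4 * x)) eq ⟩
    (b + + 4 * y) - (b + + 4 * x)   ≡⟨ solve (b ∷ x ∷ y ∷ []) ⟩
    + 4 * (y - x)                   ∎

+4*-cancelˡ : ∀ a {x y} → a + + 4 * x ≡ a + + 4 * y → x ≡ y
+4*-cancelˡ a {x} {y} eq = ℤP.*-cancelˡ-≡ (+ 4) x y (∙-cancelˡ a _ _ eq)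

module Base4
  {D : Set} (val : D → ℤ) (isZero : D → Bool) (zero : D) (val-zero : val zero ≡ 0ℤ)
  (isZero-zero : isZero zero ≡ true) (isZero⇒zero : ∀ d → T (isZero d) → d ≡ zero)
  where

  eval : List D → ℤ
  eval []       = 0ℤ
  eval (d ∷ ds) = val d + + 4 * eval ds

  normal : List D → Bool
  normal []           = true
  normal (d ∷ [])     = not (isZero d)
  normal (_ ∷ e ∷ ds) = normal (e ∷ ds)

  Rep : ℤ → Set
  Rep n = Σ (List D) λ ds → T (normal ds) × eval ds ≡ n

  Rep-resp-≗ : {ev : List D → ℤ} {nm : List D → Bool} →
               (∀ ds → ev ds ≡ eval ds) → (∀ ds → nm ds ≡ normal ds) →
               ∀ {n} → (Σ (List D) λ ds → T (nm ds) × ev ds ≡ n) ↔ Rep n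
  Rep-resp-≗ ev≗ nm≗ = mk↔ₛ′
    (λ (ds , p , eq) → ds , subst T (nm≗ ds) p , trans (sym (ev≗ ds)) eq)
    (λ (ds , p , eq) → ds , subst T (sym (nm≗ ds)) p , trans (ev≗ ds) eq)
    (λ _ → proj₁-injective refl) (λ _ → proj₁-injective refl)

  lowest : List D → D
  lowest []      = zero
  lowest (d ∷ _) = d

  higher : List D → List D
  higher []       = []
  higher (_ ∷ ds) = ds

  lowest-higher-eval : ∀ ds → val (lowest ds) + + 4 * eval (higher ds) ≡ eval ds
  lowest-higher-eval []      = trans (ℤP.+-identityʳ (val zero)) val-zero
  lowest-higher-eval (_ ∷ _) = refl

  higher-normal : ∀ ds → T (normal ds) → T (normal (higher ds))
  higher-normal []          _ = tt
  higher-normal (_ ∷ [])    _ = tt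
  higher-normal (_ ∷ _ ∷ _) p = p

  -- the inverse of (lowest, higher) on normal digit lists: a zero digit is not
  -- prepended to the empty list
  infixr 5 _◃_
  _◃_ : D → List D → List D
  d ◃ []       = if isZero d then [] else d ∷ []
  d ◃ (e ∷ es) = d ∷ e ∷ es

  ◃-lowest : ∀ d ds → lowest (d ◃ ds) ≡ d
  ◃-lowest d [] with isZero d in z
  ... | true  = sym (isZero⇒zero d (subst T (sym z) tt))
  ... | false = refl
  ◃-lowest d (_ ∷ _) = refl

  ◃-higher : ∀ d ds → higher (d ◃ ds) ≡ ds
  ◃-higher d [] with isZero d
  ... | true  = refl
  ... | false = refl
  ◃-higher d (_ ∷ _) = refl

  ◃-eval : ∀ d ds → eval (d ◃ ds) ≡ val d + + 4 * eval ds
  ◃-eval d [] with isZero d in z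
  ... | true  = sym (begin
    val d + 0ℤ     ≡⟨ ℤP.+-identityʳ (val d) ⟩
    val d          ≡⟨ cong val (isZero⇒zero d (subst T (sym z) tt)) ⟩
    val zero       ≡⟨ val-zero ⟩
    0ℤ             ∎)
    where open ≡-Reasoning
  ... | false = refl
  ◃-eval d (_ ∷ _) = refl

  ◃-normal : ∀ d ds → T (normal ds) → T (normal (d ◃ ds))
  ◃-normal d [] _ with isZero d in z
  ... | true  = tt
  ... | false = subst (T ∘ not) (sym z) tt
  ◃-normal d (_ ∷ _) p = p

  lowest-◃-higher : ∀ ds → T (normal ds) → lowest ds ◃ higher ds ≡ ds
  lowest-◃-higher []          _ rewrite isZero-zero = refl
  lowest-◃-higher (d ∷ [])    p with isZero d
  ... | false = refl
  ... | true  = ⊥-elim p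
  lowest-◃-higher (_ ∷ _ ∷ _) _ = refl

  RepWithLowest : D → ℤ → Set
  RepWithLowest d n = Σ[ k ∈ ℤ ] (val d + + 4 * k ≡ n) × Rep k

  lowest-≡ : ∀ {n} {x y : Σ D λ d → RepWithLowest d n} → proj₁ x ≡ proj₁ y →
             proj₁ (proj₂ (proj₂ (proj₂ x))) ≡ proj₁ (proj₂ (proj₂ (proj₂ y))) → x ≡ y
  lowest-≡ {x = d , _ , refl , ds , p , refl} {y = .d , _ , eq , .ds , q , refl} refl refl with eq
  ... | refl = cong (λ r → d , _ , refl , ds , r , refl) (T-irrelevant p q)

  Rep↔lowest : ∀ {n} → Rep n ↔ Σ D λ d → RepWithLowest d n
  Rep↔lowest = mk↔ₛ′ split join split-join join-split
    where
    split : ∀ {n} → Rep n → Σ D λ d → RepWithLowest d n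
    split (ds , p , eq) =
      lowest ds , eval (higher ds) , trans (lowest-higher-eval ds) eq ,
      higher ds , higher-normal ds p , refl
    join : ∀ {n} → (Σ D λ d → RepWithLowest d n) → Rep n
    join (d , _ , eq , ds , p , refl) = d ◃ ds , ◃-normal d ds p , trans (◃-eval d ds) eq
    split-join : ∀ {n} (x : Σ D λ d → RepWithLowest d n) → split (join x) ≡ x
    split-join (d , _ , refl , ds , _ , refl) = lowest-≡ (◃-lowest d ds) (◃-higher d ds)
    join-split : ∀ {n} (r : Rep n) → join (split r) ≡ r
    join-split (ds , p , _) = proj₁-injective (lowest-◃-higher ds p)

  RepWithLowest↔ : ∀ {d k n} → val d + + 4 * k ≡ n → RepWithLowest d n ↔ Rep k
  RepWithLowest↔ {d} {k} refl = mk↔ₛ′ to (λ r → k , refl , r) to-from from-to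
    where
    to : RepWithLowest d (val d + + 4 * k) → Rep k
    to (_ , eq , r) = subst Rep (+4*-cancelˡ (val d) eq) r
    to-from : ∀ r → to (k , refl , r) ≡ r
    to-from r with +4*-cancelˡ (val d) {k} refl
    ... | refl = refl
    from-to : ∀ x → (k , refl , to x) ≡ x
    from-to (_ , eq , r) with +4*-cancelˡ (val d) eq
    ... | refl with eq
    ...   | refl = refl

  RepWithLowest-≡₄ : ∀ {d} d₁ k → RepWithLowest d (val d₁ + + 4 * k) → val d ≡₄ val d₁
  RepWithLowest-≡₄ {d} d₁ k (k′ , eq , _) = +4*-≡₄ {val d} {val d₁} {k′} {k} eq

  peel-lowest₁ : ∀ d₁ {k} → (∀ d → val d ≡₄ val d₁ → d ≡ d₁) → Rep (val d₁ + + 4 * k) ↔ Rep k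
  peel-lowest₁ d₁ {k} only = ↔-trans Rep↔lowest (↔-trans
    (Σ-supported₁ d₁ (λ d r → only d (RepWithLowest-≡₄ d₁ k r)))
    (RepWithLowest↔ refl))

  peel-lowest₂ : ∀ {d₁ d₂ k k₂} → d₁ ≢ d₂ → (∀ d → val d ≡₄ val d₁ → d ≡ d₁ ⊎ d ≡ d₂) →
                 val d₂ + + 4 * k₂ ≡ val d₁ + + 4 * k → Rep (val d₁ + + 4 * k) ↔ (Rep k ⊎ Rep k₂)
  peel-lowest₂ {d₁} {k = k} d₁≢d₂ only carry = ↔-trans Rep↔lowest (↔-trans
    (Σ-supported₂ d₁≢d₂ (λ d r → only d (RepWithLowest-≡₄ d₁ k r)))
    (RepWithLowest↔ refl ⊎-cong RepWithLowest↔ carry))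

  card-Rep-0 : (∀ d {k} → val d + + 4 * k ≡ 0ℤ → Rep k → d ≡ zero) → HasCard (Rep 0ℤ) 1
  card-Rep-0 only-zero =
    mk↔ₛ′ (λ _ → Fin.zero) (λ _ → [] , tt , refl) (λ { Fin.zero → refl ; (Fin.suc ()) })
    (λ (ds , p , eq) → proj₁-injective (sym (only-[] ds p eq)))
    where
    only-[] : ∀ ds → T (normal ds) → eval ds ≡ 0ℤ → ds ≡ []
    only-[] [] _ _ = refl
    only-[] (d ∷ ds) p eq with only-zero d eq (ds , higher-normal (d ∷ ds) p , refl)
    ... | refl with only-[] ds (higher-normal (d ∷ ds) p)
                      (+4*-cancelˡ 0ℤ {eval ds} {0ℤ} (trans (cong (_+ + 4 * eval ds) (sym val-zero)) eq))
    ...   | refl = ⊥-elim (subst (T ∘ not) isZero-zero p)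

  eval-nonneg : (∀ d → 0ℤ ℤ.≤ val d) → ∀ ds → 0ℤ ℤ.≤ eval ds
  eval-nonneg nonneg []       = ℤP.≤-refl
  eval-nonneg nonneg (d ∷ ds) =
    ℤP.+-mono-≤ (nonneg d) (ℤP.*-monoˡ-≤-nonNeg (+ 4) (eval-nonneg nonneg ds))

pattern h0 = Fin.zero
pattern h1 = Fin.suc Fin.zero
pattern h2 = Fin.suc (Fin.suc Fin.zero)
pattern h3 = Fin.suc (Fin.suc (Fin.suc Fin.zero))
pattern h4 = Fin.suc (Fin.suc (Fin.suc (Fin.suc Fin.zero)))

hval : HDigit → ℤ
hval d = + toℕ d

isZeroH⇒h0 : ∀ d → T (isZeroH d) → d ≡ h0
isZeroH⇒h0 h0 _ = refl

isZeroB⇒z0 : ∀ d → T (isZeroB d) → d ≡ z0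
isZeroB⇒z0 z0 _ = refl

module H = Base4 hval isZeroH h0 refl refl isZeroH⇒h0
module B = Base4 bval isZeroB z0 refl refl isZeroB⇒z0

HRep↔ : ∀ {n} → HRep n ↔ H.Rep n
HRep↔ = H.Rep-resp-≗ evalH≗ normH≗
  where
  evalH≗ : ∀ ds → evalH ds ≡ H.eval ds
  evalH≗ []       = refl
  evalH≗ (d ∷ ds) = cong (λ e → hval d + + 4 * e) (evalH≗ ds)
  normH≗ : ∀ ds → normH ds ≡ H.normal ds
  normH≗ []           = refl
  normH≗ (_ ∷ [])     = refl
  normH≗ (_ ∷ e ∷ ds) = normH≗ (e ∷ ds)

BRep↔ : ∀ {n} → BRep n ↔ B.Rep n
BRep↔ = B.Rep-resp-≗ evalB≗ normB≗
  where
  evalB≗ : ∀ ds → evalB ds ≡ B.eval ds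
  evalB≗ []       = refl
  evalB≗ (d ∷ ds) = cong (λ e → bval d + + 4 * e) (evalB≗ ds)
  normB≗ : ∀ ds → normB ds ≡ B.normal ds
  normB≗ []           = refl
  normB≗ (_ ∷ [])     = refl
  normB≗ (_ ∷ e ∷ ds) = normB≗ (e ∷ ds)

H-digit≡₄1 : ∀ d → hval d ≡₄ + 1 → d ≡ h1
H-digit≡₄1 = λ { h1 _ → refl ; h0 () ; h2 () ; h3 () ; h4 () }

H-digit≡₄2 : ∀ d → hval d ≡₄ + 2 → d ≡ h2
H-digit≡₄2 = λ { h2 _ → refl ; h0 () ; h1 () ; h3 () ; h4 () }

H-digit≡₄3 : ∀ d → hval d ≡₄ + 3 → d ≡ h3
H-digit≡₄3 = λ { h3 _ → refl ; h0 () ; h1 () ; h2 () ; h4 () }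

H-digit≡₄4 : ∀ d → hval d ≡₄ + 4 → d ≡ h4 ⊎ d ≡ h0
H-digit≡₄4 = λ { h4 _ → inj₁ refl ; h0 _ → inj₂ refl ; h1 () ; h2 () ; h3 () }

B-digit≡₄0 : ∀ d → bval d ≡₄ + 0 → d ≡ z0
B-digit≡₄0 = λ { z0 _ → refl ; m2 () ; m1 () ; p1 () ; p2 () }

B-digit≡₄1 : ∀ d → bval d ≡₄ + 1 → d ≡ p1
B-digit≡₄1 = λ { p1 _ → refl ; m2 () ; m1 () ; z0 () ; p2 () }

B-digit≡₄-1 : ∀ d → bval d ≡₄ - + 1 → d ≡ m1
B-digit≡₄-1 = λ { m1 _ → refl ; m2 () ; z0 () ; p1 () ; p2 () }

B-digit≡₄2 : ∀ d → bval d ≡₄ + 2 → d ≡ p2 ⊎ d ≡ m2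
B-digit≡₄2 = λ { p2 _ → inj₁ refl ; m2 _ → inj₂ refl ; m1 () ; z0 () ; p1 () }

H-no-negative : ∀ {k} → ¬ H.Rep -[1+ k ]
H-no-negative (ds , _ , eq) with subst (0ℤ ℤ.≤_) eq (H.eval-nonneg (λ _ → ℤ.+≤+ z≤n) ds)
... | ()

H-card-negative : ∀ {k} → HasCard (H.Rep -[1+ k ]) 0
H-card-negative = mk↔ₛ′ (⊥-elim ∘ H-no-negative) (λ ()) (λ ()) (⊥-elim ∘ H-no-negative)

H-card-0 : HasCard (H.Rep 0ℤ) 1
H-card-0 = H.card-Rep-0 only-h0
  where
  only-h0 : ∀ d {k} → hval d + + 4 * k ≡ 0ℤ → H.Rep k → d ≡ h0
  only-h0 d {k} eq r with H-digit≡₄4 d (+4*-≡₄ {hval d} {+ 4} {k} { -[1+ 0 ]} eq)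
  ... | inj₂ d≡h0 = d≡h0
  ... | inj₁ refl = ⊥-elim (H-no-negative (subst H.Rep (+4*-cancelˡ (+ 4) {k} { -[1+ 0 ]} eq) r))

B-card-0 : HasCard (B.Rep 0ℤ) 1
B-card-0 = B.card-Rep-0 λ d {k} eq _ → B-digit≡₄0 d (+4*-≡₄ {bval d} {0ℤ} {k} {0ℤ} eq)

H-card-1 : HasCard (H.Rep (+ 1)) 1
H-card-1 = ↔-trans (H.peel-lowest₁ h1 {0ℤ} H-digit≡₄1) H-card-0

B-card-1 : HasCard (B.Rep (+ 1)) 1
B-card-1 = ↔-trans (B.peel-lowest₁ p1 {0ℤ} B-digit≡₄1) B-card-0

sum-upTo-suc : ∀ (g : ℕ → ℕ) → (∀ i → g (suc i) ≡ 4 ℕ.* g i) →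
               ∀ j → sum (map g (upTo (suc j))) ≡ g 0 ℕ.+ 4 ℕ.* sum (map g (upTo j))
sum-upTo-suc g g-suc j = cong (g 0 ℕ.+_) (begin
  sum (map g (applyUpTo suc j))    ≡⟨ cong sum (map-applyUpTo suc g j) ⟩
  sum (applyUpTo (g ∘ suc) j)      ≡⟨ cong sum (map-upTo (g ∘ suc) j) ⟨
  sum (map (g ∘ suc) (upTo j))     ≡⟨ sum-map-g∘suc (upTo j) ⟩
  4 ℕ.* sum (map g (upTo j))       ∎)
  where
  open ≡-Reasoning
  sum-map-g∘suc : ∀ xs → sum (map (g ∘ suc) xs) ≡ 4 ℕ.* sum (map g xs)
  sum-map-g∘suc []       = sym (ℕP.*-zeroʳ 4)
  sum-map-g∘suc (x ∷ xs) =
    trans (cong₂ ℕ._+_ (g-suc x) (sum-map-g∘suc xs)) (sym (ℕP.*-distribˡ-+ 4 (g x) _))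

Uj-suc : ∀ j → Uj (suc j) ≡ + 1 + + 4 * Uj j
Uj-suc j = trans (cong +_ (sum-upTo-suc (4 ℕ.^_) (λ _ → refl) j))
                 (cong (_+_ (+ 1)) (ℤP.pos-* 4 ∣ Uj j ∣))

Tj-suc : ∀ j → Tj (suc j) ≡ + 2 + + 4 * Tj j
Tj-suc j = trans (cong +_ (sum-upTo-suc (λ i → 2 ℕ.* 4 ℕ.^ i) (λ i → x∙yz≈y∙xz 2 4 (4 ℕ.^ i)) j))
                 (cong (_+_ (+ 2)) (ℤP.pos-* 4 ∣ Tj j ∣))

data BalancedDivision : ℤ → Set where
  rem-1 : ∀ q → BalancedDivision (- + 1 + + 4 * q)
  rem0  : ∀ q → BalancedDivision (+ 0 + + 4 * q)
  rem1  : ∀ q → BalancedDivision (+ 1 + + 4 * q)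
  rem2  : ∀ q → BalancedDivision (+ 2 + + 4 * q)

balancedDivision : ∀ n → BalancedDivision n
balancedDivision n = from-remainder (n %ℕ 4) (n /ℕ 4) (n%ℕd<d n 4) (a≡a%ℕn+[a/ℕn]*n n 4)
  where
  from-remainder : ∀ {n} r q → r ℕ.< 4 → n ≡ + r + q * + 4 → BalancedDivision n
  from-remainder 0 q _ refl rewrite ℤP.*-comm q (+ 4) = rem0 q
  from-remainder 1 q _ refl rewrite ℤP.*-comm q (+ 4) = rem1 q
  from-remainder 2 q _ refl rewrite ℤP.*-comm q (+ 4) = rem2 q
  from-remainder 3 q _ refl = subst BalancedDivision (three q) (rem-1 (q + + 1))
    where
    three : ∀ q → - + 1 + + 4 * (q + + 1) ≡ + 3 + q * + 4
    three = solve-∀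
  from-remainder (suc (suc (suc (suc _)))) _ (s≤s (s≤s (s≤s (s≤s ())))) _

balanced-carry : ∀ q → - + 2 + + 4 * (q + + 1) ≡ + 2 + + 4 * q
balanced-carry = solve-∀

InRange : ℕ → ℤ → Set
InRange j n = - Uj j ℤ.≤ n × n ℤ.≤ Uj (suc j)

4*a≤4*b+3⇒a≤b : ∀ {a b} → + 4 * a ℤ.≤ + 4 * b + + 3 → a ℤ.≤ b
4*a≤4*b+3⇒a≤b {a} {b} le = subst (a ℤ.≤_) (ℤP.pred-suc b) (ℤP.i<j⇒i≤pred[j] a<1+b)
  where
  open ℤP.≤-Reasoning
  a<1+b : a ℤ.< + 1 + b
  a<1+b = ℤP.*-cancelˡ-<-nonNeg (+ 4) (ℤP.suc[i]≤j⇒i<j (begin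
    + 1 + + 4 * a           ≤⟨ ℤP.+-monoʳ-≤ (+ 1) le ⟩
    + 1 + (+ 4 * b + + 3)   ≡⟨ solve (b ∷ []) ⟩
    + 4 * (+ 1 + b)         ∎))

quotient-bounds : ∀ {U U′ U″ r} q → - + 2 ℤ.≤ r → r ℤ.≤ + 2 →
                  U′ ≡ + 1 + + 4 * U → U″ ≡ + 1 + + 4 * U′ →
                  - U′ ℤ.≤ r + + 4 * q → r + + 4 * q ℤ.≤ U″ → - U ℤ.≤ q × q ℤ.≤ U′
quotient-bounds {U} {r = r} q -2≤r r≤2 refl refl lo hi = 4*a≤4*b+3⇒a≤b lower , 4*a≤4*b+3⇒a≤b upper
  where
  open ℤP.≤-Reasoning
  lower : + 4 * - U ℤ.≤ + 4 * q + + 3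
  lower = begin
    + 4 * - U                 ≡⟨ solve (U ∷ []) ⟩
    - (+ 1 + + 4 * U) + + 1   ≤⟨ ℤP.+-monoˡ-≤ (+ 1) lo ⟩
    r + + 4 * q + + 1         ≤⟨ ℤP.+-monoˡ-≤ (+ 1) (ℤP.+-monoˡ-≤ (+ 4 * q) r≤2) ⟩
    + 2 + + 4 * q + + 1       ≡⟨ solve (q ∷ []) ⟩
    + 4 * q + + 3             ∎
  upper : + 4 * q ℤ.≤ + 4 * (+ 1 + + 4 * U) + + 3
  upper = begin
    + 4 * q                             ≡⟨ solve (r ∷ q ∷ []) ⟩
    (r + + 4 * q) - r                   ≤⟨ ℤP.+-mono-≤ hi (ℤP.neg-mono-≤ -2≤r) ⟩
    + 1 + + 4 * (+ 1 + + 4 * U) + + 2   ≡⟨ solve (U ∷ []) ⟩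
    + 4 * (+ 1 + + 4 * U) + + 3         ∎

bval-bounds : ∀ d → - + 2 ℤ.≤ bval d × bval d ℤ.≤ + 2
bval-bounds m2 = ℤP.≤-refl , ℤ.-≤+
bval-bounds m1 = ℤ.-≤- z≤n , ℤ.-≤+
bval-bounds z0 = ℤ.-≤+ , ℤ.+≤+ z≤n
bval-bounds p1 = ℤ.-≤+ , ℤ.+≤+ (s≤s z≤n)
bval-bounds p2 = ℤ.-≤+ , ℤP.≤-refl

quotient-in-range : ∀ j d q → InRange (suc j) (bval d + + 4 * q) → InRange j q
quotient-in-range j d q (lo , hi) =
  quotient-bounds q (proj₁ (bval-bounds d)) (proj₂ (bval-bounds d)) (Uj-suc j) (Uj-suc (suc j)) lo hi

Counts : ℕ → ℤ → ℕ → ℕ → Set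
Counts j n a b = HasCard (H.Rep (Tj j + n)) a × HasCard (B.Rep n) b

Tj-suc-+ : ∀ j r q → Tj (suc j) + (r + + 4 * q) ≡ + 2 + r + + 4 * (Tj j + q)
Tj-suc-+ j r q = trans (cong (_+ (r + + 4 * q)) (Tj-suc j)) (regroup (Tj j) r q)
  where
  regroup : ∀ t r q → + 2 + + 4 * t + (r + + 4 * q) ≡ + 2 + r + + 4 * (t + q)
  regroup = solve-∀

digit-step : ∀ j r {q a b} →
             (∀ {k} → H.Rep (+ 2 + r + + 4 * k) ↔ H.Rep k) → (∀ {k} → B.Rep (r + + 4 * k) ↔ B.Rep k) →
             Counts j q a b → Counts (suc j) (r + + 4 * q) a b
digit-step j r {q} H-peel B-peel (h , b) =
  subst (λ x → HasCard (H.Rep x) _) (sym (Tj-suc-+ j r q)) (↔-trans H-peel h) , ↔-trans B-peel b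

carry-step : ∀ j {q a₁ b₁ a₂ b₂} → Counts j q a₁ b₁ → Counts j (q + + 1) a₂ b₂ →
             Counts (suc j) (+ 2 + + 4 * q) (a₁ ℕ.+ a₂) (b₁ ℕ.+ b₂)
carry-step j {q} (h₁ , b₁) (h₂ , b₂) =
  subst (λ x → HasCard (H.Rep x) _) (sym (Tj-suc-+ j (+ 2) q))
    (↔-trans (H.peel-lowest₂ (λ ()) H-digit≡₄4 (hyper-carry (Tj j) q)) (HasCard-⊎ h₁ h₂)) ,
  ↔-trans (B.peel-lowest₂ (λ ()) B-digit≡₄2 (balanced-carry q)) (HasCard-⊎ b₁ b₂)
  where
  hyper-carry : ∀ t q → + 0 + + 4 * (t + (q + + 1)) ≡ + 4 + + 4 * (t + q)
  hyper-carry = solve-∀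

counts-agree : ∀ j n → InRange j n → Σ ℕ λ m → Counts j n m m
counts-agree zero (+ 0)               _                      = 1 , H-card-0 , B-card-0
counts-agree zero (+ 1)               _                      = 1 , H-card-1 , B-card-1
counts-agree zero (+ suc (suc _))     (_ , ℤ.+≤+ (s≤s ()))
counts-agree zero -[1+ _ ]            (() , _)
counts-agree (suc j) n range with balancedDivision n
... | rem-1 q = map₂ (digit-step j (- + 1) (H.peel-lowest₁ h1 H-digit≡₄1) (B.peel-lowest₁ m1 B-digit≡₄-1))
                     (counts-agree j q (quotient-in-range j m1 q range))
... | rem0 q  = map₂ (digit-step j (+ 0) (H.peel-lowest₁ h2 H-digit≡₄2) (B.peel-lowest₁ z0 B-digit≡₄0))
                     (counts-agree j q (quotient-in-range j z0 q range))
... | rem1 q  = map₂ (digit-step j (+ 1) (H.peel-lowest₁ h3 H-digit≡₄3) (B.peel-lowest₁ p1 B-digit≡₄1))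
                     (counts-agree j q (quotient-in-range j p1 q range))
... | rem2 q  =
  let (m₁ , c₁) = counts-agree j q (quotient-in-range j p2 q range)
      (m₂ , c₂) = counts-agree j (q + + 1)
                    (quotient-in-range j m2 (q + + 1)
                      (subst (InRange (suc j)) (sym (balanced-carry q)) range))
  in m₁ ℕ.+ m₂ , carry-step j c₁ c₂

counts-below : ∀ j → Σ ℕ λ a → Counts j (- Uj j - + 1) a (suc a)
counts-below zero = 0 , H-card-negative , ↔-trans (B.peel-lowest₁ m1 {0ℤ} B-digit≡₄-1) B-card-0
counts-below (suc j) =
  let (a , c) = counts-below j
      (m , c′) = counts-agree j (- Uj j) (ℤP.≤-refl , ℤP.neg-≤-pos)
  in a ℕ.+ m ,
     subst (λ n → Counts (suc j) n (a ℕ.+ m) (suc a ℕ.+ m)) (sym below-carry)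
       (carry-step j c (subst (λ n → Counts j n m m) (sym (-u-1+1 (Uj j))) c′))
  where
  -u-1+1 : ∀ u → - u - + 1 + + 1 ≡ - u
  -u-1+1 = solve-∀
  regroup : ∀ u → - (+ 1 + + 4 * u) - + 1 ≡ + 2 + + 4 * (- u - + 1)
  regroup = solve-∀
  below-carry : - Uj (suc j) - + 1 ≡ + 2 + + 4 * (- Uj j - + 1)
  below-carry = trans (cong (λ u → - u - + 1) (Uj-suc j)) (regroup (Uj j))

counts-above : ∀ j → Σ ℕ λ a → Counts j (Uj (suc j) + + 1) a (suc a)
counts-above zero =
  1 , ↔-trans (H.peel-lowest₁ h2 {0ℤ} H-digit≡₄2) H-card-0 ,
      ↔-trans (B.peel-lowest₂ {k = 0ℤ} {k₂ = + 1} (λ ()) B-digit≡₄2 refl) (HasCard-⊎ B-card-0 B-card-1)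
counts-above (suc j) =
  let (m , c) = counts-agree j (Uj (suc j)) (ℤP.neg-≤-pos , ℤP.≤-refl)
      (a , c′) = counts-above j
  in m ℕ.+ a ,
     subst (λ n → Counts (suc j) n (m ℕ.+ a) (suc (m ℕ.+ a))) (sym above-carry)
       (subst (Counts (suc j) _ (m ℕ.+ a)) (ℕP.+-suc m a) (carry-step j c c′))
  where
  regroup : ∀ u → + 1 + + 4 * u + + 1 ≡ + 2 + + 4 * u
  regroup = solve-∀
  above-carry : Uj (suc (suc j)) + + 1 ≡ + 2 + + 4 * Uj (suc j)
  above-carry = trans (cong (_+ + 1) (Uj-suc (suc j))) (regroup (Uj (suc j)))

Counts⇒f4≡×b4≡ : ∀ j {n a b} → Counts j n a b → f4≡ (Tj j + n) a × b4≡ n b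
Counts⇒f4≡×b4≡ _ (h , b) = ↔-trans HRep↔ h , ↔-trans BRep↔ b

theorem1p2 : (j : ℕ) → 1 ≤ j →
    ((n : ℤ) → - Uj j ℤ.≤ n → n ℤ.≤ Uj (suc j) →
      Σ ℕ λ m → f4≡ (Tj j + n) m × b4≡ n m)
    × (Σ ℕ λ a → Σ ℕ λ b →
        f4≡ (Tj j + (- Uj j - + 1)) a × b4≡ (- Uj j - + 1) b × a ≢ b)
    × (Σ ℕ λ a → Σ ℕ λ b →
        f4≡ (Tj j + (Uj (suc j) + + 1)) a × b4≡ (Uj (suc j) + + 1) b × a ≢ b)
theorem1p2 j _ =
  (λ n lo hi → map₂ (Counts⇒f4≡×b4≡ j) (counts-agree j n (lo , hi))) ,
  off-by-one (counts-below j) ,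
  off-by-one (counts-above j)
  where
  off-by-one : ∀ {n} → (Σ ℕ λ a → Counts j n a (suc a)) →
               Σ ℕ λ a → Σ ℕ λ b → f4≡ (Tj j + n) a × b4≡ n b × a ≢ b
  off-by-one (a , c) =
    let (h , b) = Counts⇒f4≡×b4≡ j c in a , suc a , h , b , ℕP.1+n≢n ∘ sym
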